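{- For any two connected graphs $G$ and $H$ with $|G| \ge 2$ and $|H| \ge 2$, $md(G \boxtimes H) = 1$.
   Context: The strong product $G \boxtimes H$ has vertex set $V(G)\times V(H)$, with distinct $(u,v)$ and $(u',v')$ adjacent if and only if either $uu' \in E(G)$ and $v=v'$, or $vv' \in E(H)$ and $u=u'$, or $uu'\in E(G)$ and $vv' \in E(H)$. $|G|$ is the number of vertices. An edge-coloring of a graph $G$ is a map $\Gamma: E(G) \to [k]$ (adjacent edges may receive the same color). An edge-cut is monochromatic if all of its edges have the same color. An edge-coloring of $G$ is a monochromatic disconnection coloring (MD-coloring) if any two distinct vertices $u,v$ of $G$ are separated by a monochromatic edge-cut (equivalently, for some color $i$, $u$ and $v$ lie in different components of the graph obtained by deleting all edges of color $i$). For a connected graph $G$, $md(G)$ is the maximum number of colors in an MD-coloring of $G$. -}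

module Defs where

open import Data.Nat using (ℕ; _≤_)
open import Data.Fin using (Fin)
open import Data.Product using (Σ; _×_; ∃; ∃-syntax; _,_)
open import Data.Sum using (_⊎_)
open import Relation.Nullary using (¬_)
open import Relation.Binary.PropositionalEquality using (_≡_; _≢_)
open import Relation.Binary.Construct.Closure.ReflexiveTransitive using (Star)

record Graph (V : Set) : Set₁ where
  field
    Adj : V → V → Set

open Graph public

IsSimple : {V : Set} → Graph V → Set
IsSimple {V} G = (∀ u v → Adj G u v → Adj G v u) × (∀ u → ¬ Adj G u u)

Connected : {V : Set} → Graph V → Set
Connected {V} G = ∀ (u v : V) → Star (Adj G) u v

_⊠_ : {V W : Set} → Graph V → Graph W → Graph (V × W)
Adj (G ⊠ H) (u , v) (u' , v') =
  ((u , v) ≢ (u' , v')) ×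
  ((Adj G u u' × v ≡ v') ⊎ (Adj H v v' × u ≡ u') ⊎ (Adj G u u' × Adj H v v'))

-- An edge-coloring with colours in Fin k: a colour for each ordered pair,
-- required to agree on both orientations of every edge
-- (values on non-edges are irrelevant).
record EdgeColoring {V : Set} (G : Graph V) (k : ℕ) : Set where
  field
    col : V → V → Fin k
    col-sym : ∀ u v → Adj G u v → col u v ≡ col v u

open EdgeColoring public

-- The coloring uses all k colours (so k = number of colours used).
UsesAllColours : {V : Set} {G : Graph V} {k : ℕ} → EdgeColoring G k → Set
UsesAllColours {V} {G} {k} Γ = ∀ (i : Fin k) → ∃[ u ] ∃[ v ] (Adj G u v × col Γ u v ≡ i)

DeleteColour : {V : Set} {G : Graph V} {k : ℕ} → EdgeColoring G k → Fin k → Graph V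
Adj (DeleteColour {G = G} Γ i) x y = Adj G x y × col Γ x y ≢ i

-- MD-coloring: any two distinct vertices are separated by a monochromatic edge-cut,
-- i.e. for some colour i they lie in different components after deleting colour i.
IsMD : {V : Set} {G : Graph V} {k : ℕ} → EdgeColoring G k → Set
IsMD {V} {G} {k} Γ = ∀ (u v : V) → u ≢ v →
  ∃[ i ] ¬ Star (Adj (DeleteColour Γ i)) u v

-- md(G) = m : m is the maximum number of colours in an MD-coloring of G.
MdEq : {V : Set} → Graph V → ℕ → Set
MdEq G m =
  (Σ (EdgeColoring G m) λ Γ → UsesAllColours Γ × IsMD Γ) ×
  (∀ (k : ℕ) (Γ : EdgeColoring G k) → UsesAllColours Γ → IsMD Γ → k ≤ m)

module Submission where

-- The constant colouring with one colour is an MD-colouring of any graph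
-- with an edge, so md ≥ 1.  For the upper bound we show that every
-- MD-colouring of G ⊠ H uses a single colour:
--   * in an MD-colouring of a simple graph every triangle is monochromatic,
--     because a colour separating two adjacent vertices must appear both on
--     the edge between them and on every 2-path joining them;
--   * in G ⊠ H, any two neighbours of a vertex p are linked by a chain of
--     neighbours of p, consecutive ones adjacent to each other, so all
--     edges at p carry the same colour (the colouring is locally
--     monochromatic);
--   * on a connected graph a locally monochromatic colouring gives all
--     edges one colour, so a colouring using all k colours has k ≤ 1.
-- The file develops the general colouring facts first, then the strong
-- product, and finally derives theorem4p5.

open import Defs
open import Data.Nat using (ℕ; _≤_; zero; suc; z≤n; s≤s)
open import Data.Fin using (Fin; _≟_) renaming (zero to fz; suc to fs)
open import Data.Product using (Σ; _×_; ∃-syntax; _,_; proj₁; proj₂)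
open import Data.Sum using (_⊎_; inj₁; inj₂)
open import Data.Empty using (⊥-elim)
open import Relation.Nullary using (¬_; yes; no)
open import Relation.Binary.PropositionalEquality
open import Relation.Binary.Construct.Closure.ReflexiveTransitive using (Star; ε; _◅_; _◅◅_)
open ≡-Reasoning

adjacent-distinct : ∀ {V} {G : Graph V} → (∀ u → ¬ Adj G u u) →
  ∀ {x y} → Adj G x y → x ≢ y
adjacent-distinct irrefl {x} xy refl = irrefl x xy

first-step : ∀ {A : Set} {R : A → A → Set} {x y} → x ≢ y → Star R x y → ∃[ z ] R x z
first-step x≢x ε = ⊥-elim (x≢x refl)
first-step _ (xz ◅ _) = _ , xz

has-neighbour : ∀ {n} (G : Graph (Fin n)) → Connected G → 2 ≤ n → ∀ u → ∃[ z ] Adj G u z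
has-neighbour G conn (s≤s (s≤s _)) u = first-step (other≢ u) (conn u (other u))
  where
    other : ∀ {n} → Fin (suc (suc n)) → Fin (suc (suc n))
    other fz = fs fz
    other (fs _) = fz

    other≢ : ∀ {n} (x : Fin (suc (suc n))) → x ≢ other x
    other≢ fz ()
    other≢ (fs _) ()

module Colouring {V : Set} {G : Graph V} {k : ℕ} (Γ : EdgeColoring G k) where

  Separates : Fin k → V → V → Set
  Separates i x y = ¬ Star (Adj (DeleteColour Γ i)) x y

  separating-edge : ∀ {i x y} → Separates i x y → Adj G x y → col Γ x y ≡ i
  separating-edge {i} {x} {y} sep xy with col Γ x y ≟ i
  ... | yes xy≡i = xy≡i
  ... | no xy≢i = ⊥-elim (sep ((xy , xy≢i) ◅ ε))

  separating-path₂ : ∀ {i x y z} → Separates i x y → Adj G x z → Adj G z y →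
    col Γ x z ≡ i ⊎ col Γ z y ≡ i
  separating-path₂ {i} {x} {y} {z} sep xz zy with col Γ x z ≟ i | col Γ z y ≟ i
  ... | yes xz≡i | _ = inj₁ xz≡i
  ... | no _ | yes zy≡i = inj₂ zy≡i
  ... | no xz≢i | no zy≢i = ⊥-elim (sep ((xz , xz≢i) ◅ (zy , zy≢i) ◅ ε))

  triangle-monochromatic : IsSimple G → IsMD Γ → ∀ {p q r} →
    Adj G p q → Adj G p r → Adj G q r → col Γ p q ≡ col Γ p r
  triangle-monochromatic (symG , irrefl) md {p} {q} {r} pq pr qr
    with md p q (adjacent-distinct irrefl pq) | md p r (adjacent-distinct irrefl pr)
  ... | i , sepᵢ | j , sepⱼ
    with separating-path₂ sepᵢ pr (symG q r qr) | separating-path₂ sepⱼ pq qr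
  ... | inj₁ pr≡i | _ = trans (separating-edge sepᵢ pq) (sym pr≡i)
  ... | inj₂ _ | inj₁ pq≡j = trans pq≡j (sym (separating-edge sepⱼ pr))
  ... | inj₂ rq≡i | inj₂ qr≡j = begin
    col Γ p q  ≡⟨ separating-edge sepᵢ pq ⟩
    i          ≡⟨ sym rq≡i ⟩
    col Γ r q  ≡⟨ sym (col-sym Γ q r qr) ⟩
    col Γ q r  ≡⟨ qr≡j ⟩
    j          ≡⟨ sym (separating-edge sepⱼ pr) ⟩
    col Γ p r  ∎

  LocallyMonochromatic : Set
  LocallyMonochromatic = ∀ {p q r} → Adj G p q → Adj G p r → col Γ p q ≡ col Γ p r

  Monochromatic : Set
  Monochromatic = ∀ {p q p' q'} → Adj G p q → Adj G p' q' → col Γ p q ≡ col Γ p' q'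

  -- On a connected graph with symmetric adjacency, local monochromaticity
  -- propagates along walks: the common colour at a vertex passes to each
  -- neighbour through the edge they share.
  locally⇒monochromatic : (∀ u v → Adj G u v → Adj G v u) → Connected G →
    LocallyMonochromatic → Monochromatic
  locally⇒monochromatic symG conn local {p} {q} {p'} {q'} pq p'q' = along (conn p p') pq
    where
      along : ∀ {x y} → Star (Adj G) x p' → Adj G x y → col Γ x y ≡ col Γ p' q'
      along ε xy = local xy p'q'
      along {x} {y} (_◅_ {j = z} xz walk) xy = begin
        col Γ x y   ≡⟨ local xy xz ⟩
        col Γ x z   ≡⟨ col-sym Γ x z xz ⟩
        col Γ z x   ≡⟨ along walk (symG x z xz) ⟩
        col Γ p' q' ∎

open Colouring using (Separates; LocallyMonochromatic; Monochromatic;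
  triangle-monochromatic; locally⇒monochromatic)

monochromatic⇒≤1 : ∀ {V} {G : Graph V} {k} (Γ : EdgeColoring G k) →
  Monochromatic Γ → UsesAllColours Γ → k ≤ 1
monochromatic⇒≤1 {k = zero} _ _ _ = z≤n
monochromatic⇒≤1 {k = suc zero} _ _ _ = s≤s z≤n
monochromatic⇒≤1 {k = suc (suc _)} Γ mono uses with uses fz | uses (fs fz)
... | _ , _ , e₀ , col₀ | _ , _ , e₁ , col₁ with trans (sym col₀) (trans (mono e₀ e₁) col₁)
... | ()

-- In a graph with an edge, the constant one-colour colouring is an
-- MD-colouring using all its colours: deleting that colour removes every edge.
constant-md : ∀ {V} {G : Graph V} {u v} → Adj G u v →
  Σ (EdgeColoring G 1) λ Γ → UsesAllColours Γ × IsMD Γ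
constant-md {G = G} {u} {v} uv = Γ₀ , uses , λ x y x≢y → fz , isolated x≢y
  where
    Γ₀ : EdgeColoring G 1
    Γ₀ = record { col = λ _ _ → fz ; col-sym = λ _ _ _ → refl }

    uses : UsesAllColours Γ₀
    uses fz = u , v , uv , refl

    isolated : ∀ {x y} → x ≢ y → Separates Γ₀ fz x y
    isolated x≢y ε = x≢y refl
    isolated _ ((_ , col≢0) ◅ _) = col≢0 refl

-- Closed adjacency: equal or adjacent.  Two vertices of G ⊠ H are equal or
-- adjacent exactly when both coordinates are.
Near : ∀ {V} → Graph V → V → V → Set
Near G a a' = a ≡ a' ⊎ Adj G a a'

near-sym : ∀ {V} {G : Graph V} → IsSimple G → ∀ {a a'} → Near G a a' → Near G a' a
near-sym _ (inj₁ refl) = inj₁ refl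
near-sym (symG , _) (inj₂ aa') = inj₂ (symG _ _ aa')

module StrongProduct {V W : Set} {G : Graph V} {H : Graph W}
  (simpleG : IsSimple G) (simpleH : IsSimple H) where

  near⇒⊠-near : ∀ {a a' b b'} → Near G a a' → Near H b b' →
    (a , b) ≡ (a' , b') ⊎ Adj (G ⊠ H) (a , b) (a' , b')
  near⇒⊠-near (inj₁ refl) (inj₁ refl) = inj₁ refl
  near⇒⊠-near (inj₁ refl) (inj₂ bb') =
    inj₂ ((λ eq → adjacent-distinct (proj₂ simpleH) bb' (cong proj₂ eq)) , inj₂ (inj₁ (bb' , refl)))
  near⇒⊠-near (inj₂ aa') (inj₁ refl) =
    inj₂ ((λ eq → adjacent-distinct (proj₂ simpleG) aa' (cong proj₁ eq)) , inj₁ (aa' , refl))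
  near⇒⊠-near (inj₂ aa') (inj₂ bb') =
    inj₂ ((λ eq → adjacent-distinct (proj₂ simpleG) aa' (cong proj₁ eq)) , inj₂ (inj₂ (aa' , bb')))

  near⇒⊠-adj : ∀ {a a' b b'} → Near G a a' → Near H b b' → (a , b) ≢ (a' , b') →
    Adj (G ⊠ H) (a , b) (a' , b')
  near⇒⊠-adj na nb ne with near⇒⊠-near na nb
  ... | inj₁ eq = ⊥-elim (ne eq)
  ... | inj₂ adj = adj

  ⊠-adj⇒near : ∀ {a a' b b'} → Adj (G ⊠ H) (a , b) (a' , b') → Near G a a' × Near H b b'
  ⊠-adj⇒near (_ , inj₁ (aa' , refl)) = inj₂ aa' , inj₁ refl
  ⊠-adj⇒near (_ , inj₂ (inj₁ (bb' , refl))) = inj₁ refl , inj₂ bb'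
  ⊠-adj⇒near (_ , inj₂ (inj₂ (aa' , bb'))) = inj₂ aa' , inj₂ bb'

  ⊠-left : ∀ {a a' b} → Adj G a a' → Adj (G ⊠ H) (a , b) (a' , b)
  ⊠-left aa' = near⇒⊠-adj (inj₂ aa') (inj₁ refl)
    (λ eq → adjacent-distinct (proj₂ simpleG) aa' (cong proj₁ eq))

  ⊠-right : ∀ {a b b'} → Adj H b b' → Adj (G ⊠ H) (a , b) (a , b')
  ⊠-right bb' = near⇒⊠-adj (inj₁ refl) (inj₂ bb')
    (λ eq → adjacent-distinct (proj₂ simpleH) bb' (cong proj₂ eq))

  ⊠-diagonal : ∀ {a a' b b'} → Adj G a a' → Adj H b b' → Adj (G ⊠ H) (a , b) (a' , b')
  ⊠-diagonal aa' bb' = near⇒⊠-adj (inj₂ aa') (inj₂ bb')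
    (λ eq → adjacent-distinct (proj₂ simpleG) aa' (cong proj₁ eq))

  ⊠-simple : IsSimple (G ⊠ H)
  ⊠-simple = symmetric , λ p p≢p → proj₁ p≢p refl
    where
      symmetric : ∀ p q → Adj (G ⊠ H) p q → Adj (G ⊠ H) q p
      symmetric _ _ pq with ⊠-adj⇒near pq
      ... | na , nb = near⇒⊠-adj (near-sym simpleG na) (near-sym simpleH nb) (λ eq → proj₁ pq (sym eq))

  ⊠-connected : Connected G → Connected H → Connected (G ⊠ H)
  ⊠-connected connG connH (u , v) (u' , v') = alongG (connG u u') ◅◅ alongH (connH v v')
    where
      alongG : ∀ {a a'} → Star (Adj G) a a' → Star (Adj (G ⊠ H)) (a , v) (a' , v)
      alongG ε = ε
      alongG (aa' ◅ walk) = ⊠-left aa' ◅ alongG walk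

      alongH : ∀ {b b'} → Star (Adj H) b b' → Star (Adj (G ⊠ H)) (u' , b) (u' , b')
      alongH ε = ε
      alongH (bb' ◅ walk) = ⊠-right bb' ◅ alongH walk

  module _ (nbG : ∀ u → ∃[ z ] Adj G u z) (nbH : ∀ v → ∃[ w ] Adj H v w)
    {k : ℕ} (Γ : EdgeColoring (G ⊠ H) k) (md : IsMD Γ) where

    -- Two neighbours of p that are equal or adjacent span an edge pair of
    -- equal colour (in the adjacent case they form a triangle with p).
    near-neighbours : ∀ {p a b a' b'} → Adj (G ⊠ H) p (a , b) → Adj (G ⊠ H) p (a' , b') →
      Near G a a' → Near H b b' → col Γ p (a , b) ≡ col Γ p (a' , b')
    near-neighbours {p} pq pq' na nb with near⇒⊠-near na nb
    ... | inj₁ q≡q' = cong (col Γ p) q≡q'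
    ... | inj₂ qq' = triangle-monochromatic Γ ⊠-simple md pq pq' qq'

    step-off : ∀ {u a} → Near G u a → ∃[ a' ] Adj G u a' × Near G a a'
    step-off {u} (inj₁ refl) = proj₁ (nbG u) , proj₂ (nbG u) , inj₂ (proj₂ (nbG u))
    step-off (inj₂ ua) = _ , ua , inj₁ refl

    -- Every edge at (u , v) has the colour of the edge to the anchor (u , w),
    -- via the chain of neighbours (a , b) ~ (a' , v) ~ (a' , w) ~ (u , w).
    toward-anchor : ∀ {u v a b} → Adj (G ⊠ H) (u , v) (a , b) →
      col Γ (u , v) (a , b) ≡ col Γ (u , v) (u , proj₁ (nbH v))
    toward-anchor {u} {v} {a} {b} pq with ⊠-adj⇒near pq | nbH v
    ... | na , nb | w , vw with step-off na
    ...   | a' , ua' , aa' = begin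
      col Γ (u , v) (a , b)   ≡⟨ near-neighbours pq toA'v aa' (near-sym simpleH nb) ⟩
      col Γ (u , v) (a' , v)  ≡⟨ near-neighbours toA'v toA'w (inj₁ refl) (inj₂ vw) ⟩
      col Γ (u , v) (a' , w)  ≡⟨ near-neighbours toA'w (⊠-right vw) (inj₂ (proj₁ simpleG u a' ua')) (inj₁ refl) ⟩
      col Γ (u , v) (u , w)   ∎
      where
        toA'v : Adj (G ⊠ H) (u , v) (a' , v)
        toA'v = ⊠-left ua'
        toA'w : Adj (G ⊠ H) (u , v) (a' , w)
        toA'w = ⊠-diagonal ua' vw

    ⊠-locally-monochromatic : LocallyMonochromatic Γ
    ⊠-locally-monochromatic pq pr = trans (toward-anchor pq) (sym (toward-anchor pr))

theorem4p5 : (n m : ℕ) (G : Graph (Fin n)) (H : Graph (Fin m)) →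
    IsSimple G → IsSimple H → Connected G → Connected H →
    2 ≤ n → 2 ≤ m → MdEq (G ⊠ H) 1
theorem4p5 (suc n) (suc m) G H simpleG simpleH connG connH 2≤n 2≤m =
  constant-md (⊠-left {b = fz} (proj₂ (nbG fz))) , at-most-one
  where
    open StrongProduct simpleG simpleH
    nbG : ∀ u → ∃[ z ] Adj G u z
    nbG = has-neighbour G connG 2≤n
    nbH : ∀ v → ∃[ w ] Adj H v w
    nbH = has-neighbour H connH 2≤m
    at-most-one : ∀ k (Γ : EdgeColoring (G ⊠ H) k) → UsesAllColours Γ → IsMD Γ → k ≤ 1
    at-most-one k Γ uses md = monochromatic⇒≤1 Γ
      (locally⇒monochromatic Γ (proj₁ ⊠-simple) (⊠-connected connG connH)
        (⊠-locally-monochromatic nbG nbH Γ md))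
      uses
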